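{- Let $x$ and $y$ be Knuth equivalent words in $\mathbf N$. Then $u_x\equiv u_y\pmod J$.
   Context: $\mathcal U$ is the free associative $\mathbf C$-algebra on generators $u_1,u_2,\dots$; for a word $x=x_1\cdots x_l$ in $\mathbf N=\{1,2,\dots\}$, $u_x=u_{x_1}\cdots u_{x_l}$. $J$ is the two-sided ideal of $\mathcal U$ generated by $u_iu_j-u_ju_i$ ($|i-j|\ge2$), $u_iu_{i+1}u_i-u_{i+1}u_iu_i$, $u_{i+1}u_{i+1}u_i-u_{i+1}u_iu_{i+1}$, and $u_{i+1}u_{i+2}u_{i+1}u_i-u_{i+1}u_{i+2}u_iu_{i+1}$ for all $i,j\ge1$. Two words are Knuth equivalent if one can be obtained from the other by a sequence of moves $\dots bac\dots \leftrightarrow \dots bca\dots$ for $a<b\leq c$ and $\dots acb\dots\leftrightarrow\dots cab\dots$ for $a\leq b<c$, where the three letters are consecutive and the rest of the word is unchanged. -}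

module Defs where

open import Level using (Level; _⊔_)
open import Data.Nat using (ℕ; _≤_; _<_; _+_)
open import Data.List using (List; []; _∷_; _++_; map; foldr)
open import Data.List.Properties using (≡-dec)
open import Data.Nat.Properties using (_≟_)
open import Data.Product using (Σ; _×_; _,_; ∃; ∃-syntax)
open import Data.Sum using (_⊎_)
open import Relation.Nullary using (yes; no)
open import Relation.Binary.PropositionalEquality using (_≡_)
open import Relation.Binary.Construct.Closure.Equivalence using (EqClosure)
open import Algebra.Bundles using (CommutativeRing)

-- Words in the alphabet of natural numbers (positivity of letters is
-- imposed separately where needed, since the paper uses N = {1,2,...}).
Word : Set
Word = List ℕ

data KnuthMove : Word → Word → Set where
  bac→bca : ∀ (p q : Word) {a b c : ℕ} → a < b → b ≤ c →
            KnuthMove (p ++ b ∷ a ∷ c ∷ q) (p ++ b ∷ c ∷ a ∷ q)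
  acb→cab : ∀ (p q : Word) {a b c : ℕ} → a ≤ b → b < c →
            KnuthMove (p ++ a ∷ c ∷ b ∷ q) (p ++ c ∷ a ∷ b ∷ q)

KnuthEquiv : Word → Word → Set
KnuthEquiv = EqClosure KnuthMove

data Positive : Word → Set where
  []  : Positive []
  _∷_ : ∀ {k w} → 1 ≤ k → Positive w → Positive (k ∷ w)

-- The defining relations of J, each written as a pair (l , r) of words
-- standing for the generator u_l - u_r of J.

data IsRel : Word → Word → Set where
  far  : ∀ {i j} → 1 ≤ i → 1 ≤ j → (i + 2 ≤ j ⊎ j + 2 ≤ i) →
         IsRel (i ∷ j ∷ []) (j ∷ i ∷ [])
  rel1 : ∀ {i} → 1 ≤ i →
         IsRel (i ∷ (i + 1) ∷ i ∷ []) ((i + 1) ∷ i ∷ i ∷ [])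
  rel2 : ∀ {i} → 1 ≤ i →
         IsRel ((i + 1) ∷ (i + 1) ∷ i ∷ []) ((i + 1) ∷ i ∷ (i + 1) ∷ [])
  rel3 : ∀ {i} → 1 ≤ i →
         IsRel ((i + 1) ∷ (i + 2) ∷ (i + 1) ∷ i ∷ [])
               ((i + 1) ∷ (i + 2) ∷ i ∷ (i + 1) ∷ [])

-- The free associative algebra over a commutative ring R, with elements
-- represented as finite formal R-linear combinations of words; two
-- elements are equal iff all their coefficients agree.

module Over {c ℓ : Level} (R : CommutativeRing c ℓ) where
  open CommutativeRing R renaming (Carrier to K; _+_ to _+ᴿ_)

  Poly : Set c
  Poly = List (K × Word)

  coeff : Poly → Word → K
  coeff [] w = 0#
  coeff ((k , v) ∷ p) w with ≡-dec _≟_ v w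
  ... | yes _ = k +ᴿ coeff p w
  ... | no  _ = coeff p w

  -- A typical summand of an element of the two-sided ideal J:
  --   k · u_a (u_l - u_r) u_b   with (l , r) a defining relation.
  record JTerm : Set c where
    constructor jterm
    field
      scal  : K
      left  : Word
      l r   : Word
      isRel : IsRel l r
      right : Word

  jtermPoly : JTerm → Poly
  jtermPoly (jterm k a l r _ b) =
    (k , a ++ l ++ b) ∷ (- k , a ++ r ++ b) ∷ []

  jPoly : List JTerm → Poly
  jPoly ts = foldr (λ t p → jtermPoly t ++ p) [] ts

  InJ : Poly → Set (c ⊔ ℓ)
  InJ f = ∃[ ts ] (∀ w → coeff f w ≈ coeff (jPoly ts) w)

  _≡J_ : Word → Word → Set (c ⊔ ℓ)
  x ≡J y = InJ ((1# , x) ∷ (- 1# , y) ∷ [])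

-- Since Knuth equivalence is generated by elementary moves and
-- congruence modulo J is an equivalence relation, it suffices to check
-- that a single move applied to a word of positive letters yields a
-- congruent monomial.  A move replaces a factor  b a c  by  b c a
-- (a < b ≤ c)  or  a c b  by  c a b  (a ≤ b < c); in both cases the
-- letters a and c are exchanged.  Either c ≥ a + 2, and the move is an
-- instance of the commutation relation u_a u_c = u_c u_a in a context,
-- or c = a + 1, which forces the remaining letter b, and the move is
-- exactly the (inverse of the) second relation or the first relation.

module Submission where

open import Level using (Level)
open import Algebra.Bundles using (CommutativeRing)
open import Defs

open import Data.Nat using (suc; _+_; _≤_; _<_; s≤s⁻¹)
open import Data.Nat.Properties
  using (_≟_; _≤?_; ≤-antisym; ≤-trans; ≰⇒>; +-comm; +-suc; +-monoˡ-≤; +-cancelʳ-≤)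
open import Data.List using ([]; _∷_; _++_; map)
open import Data.List.Properties using (≡-dec; ++-assoc)
open import Data.Product using (_,_; _×_)
open import Data.Sum using (inj₁)
open import Relation.Nullary using (yes; no)
open import Relation.Binary.PropositionalEquality as ≡
  using (_≡_; subst; subst₂; cong)
open import Relation.Binary.Construct.Closure.Symmetric using (fwd; bwd)
open import Relation.Binary.Construct.Closure.ReflexiveTransitive
  using (ε; _◅_)

positive-prefix : ∀ p {s} → Positive (p ++ s) → Positive p
positive-prefix []      _         = []
positive-prefix (_ ∷ p) (h ∷ hps) = h ∷ positive-prefix p hps

positive-suffix : ∀ p {s} → Positive (p ++ s) → Positive s
positive-suffix []      hs        = hs
positive-suffix (_ ∷ p) (_ ∷ hps) = positive-suffix p hps

positive-++ : ∀ {p s} → Positive p → Positive s → Positive (p ++ s)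
positive-++ []        hs = hs
positive-++ (h ∷ hp)  hs = h ∷ positive-++ hp hs

-- A Knuth move only permutes three letters, so it preserves and reflects
-- positivity; this lets us follow a chain of moves in both directions.

move-preserves-positive : ∀ {x y} → KnuthMove x y → Positive x → Positive y
move-preserves-positive (bac→bca p q _ _) h with positive-suffix p h
... | hb ∷ ha ∷ hc ∷ hq = positive-++ (positive-prefix p h) (hb ∷ hc ∷ ha ∷ hq)
move-preserves-positive (acb→cab p q _ _) h with positive-suffix p h
... | ha ∷ hc ∷ hb ∷ hq = positive-++ (positive-prefix p h) (hc ∷ ha ∷ hb ∷ hq)

move-reflects-positive : ∀ {x y} → KnuthMove x y → Positive y → Positive x
move-reflects-positive (bac→bca p q _ _) h with positive-suffix p h
... | hb ∷ hc ∷ ha ∷ hq = positive-++ (positive-prefix p h) (hb ∷ ha ∷ hc ∷ hq)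
move-reflects-positive (acb→cab p q _ _) h with positive-suffix p h
... | hc ∷ ha ∷ hb ∷ hq = positive-++ (positive-prefix p h) (ha ∷ hc ∷ hb ∷ hq)

<+2⇒≤+1 : ∀ {a c} → c < a + 2 → c ≤ a + 1
<+2⇒≤+1 {a} {c} c<a+2 = s≤s⁻¹ (subst (suc c ≤_) (+-suc a 1) c<a+2)

<⇒+1≤ : ∀ {a b} → a < b → a + 1 ≤ b
<⇒+1≤ {a} {b} a<b = subst (_≤ b) (+-comm 1 a) a<b

bac-near : ∀ {a b c} → a < b → b ≤ c → c < a + 2 → b ≡ a + 1 × c ≡ a + 1
bac-near a<b b≤c c<a+2 =
  ≤-antisym (≤-trans b≤c c≤a+1) (<⇒+1≤ a<b) ,
  ≤-antisym c≤a+1 (≤-trans (<⇒+1≤ a<b) b≤c)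
  where c≤a+1 = <+2⇒≤+1 c<a+2

acb-near : ∀ {a b c} → a ≤ b → b < c → c < a + 2 → b ≡ a × c ≡ a + 1
acb-near {a} {b} a≤b b<c c<a+2 =
  ≤-antisym (+-cancelʳ-≤ 1 b a (≤-trans (<⇒+1≤ b<c) c≤a+1)) a≤b ,
  ≤-antisym c≤a+1 (≤-trans (+-monoˡ-≤ 1 a≤b) (<⇒+1≤ b<c))
  where c≤a+1 = <+2⇒≤+1 c<a+2

module Congruence {c ℓ : Level} (R : CommutativeRing c ℓ) where
  open CommutativeRing R renaming (Carrier to K; _+_ to _+ᴿ_)
  open Over R
  open import Algebra.Properties.AbelianGroup +-abelianGroup
    using (⁻¹-∙-comm; ε⁻¹≈ε; ⁻¹-anti-homo‿-; \\-leftDividesʳ)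
  open import Relation.Binary.Reasoning.Setoid setoid

  infix 4 _≋_
  _≋_ : Poly → Poly → Set ℓ
  f ≋ g = ∀ w → coeff f w ≈ coeff g w

  negate : Poly → Poly
  negate []            = []
  negate ((k , v) ∷ p) = (- k , v) ∷ negate p

  coeff-++ : ∀ p q w → coeff (p ++ q) w ≈ coeff p w +ᴿ coeff q w
  coeff-++ []            q w = sym (+-identityˡ _)
  coeff-++ ((k , v) ∷ p) q w with ≡-dec _≟_ v w
  ... | yes _ = trans (+-congˡ (coeff-++ p q w)) (sym (+-assoc _ _ _))
  ... | no  _ = coeff-++ p q w

  coeff-negate : ∀ p w → coeff (negate p) w ≈ - coeff p w
  coeff-negate []            w = sym ε⁻¹≈ε
  coeff-negate ((k , v) ∷ p) w with ≡-dec _≟_ v w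
  ... | yes _ = trans (+-congˡ (coeff-negate p w)) (⁻¹-∙-comm k (coeff p w))
  ... | no  _ = coeff-negate p w

  jPoly-++ : ∀ ts us → jPoly (ts ++ us) ≡ jPoly ts ++ jPoly us
  jPoly-++ []       us = ≡.refl
  jPoly-++ (t ∷ ts) us =
    ≡.trans (cong (jtermPoly t ++_) (jPoly-++ ts us))
            (≡.sym (++-assoc (jtermPoly t) (jPoly ts) (jPoly us)))

  negateJTerm : JTerm → JTerm
  negateJTerm (jterm k a l r i b) = jterm (- k) a l r i b

  jPoly-negate : ∀ ts → jPoly (map negateJTerm ts) ≡ negate (jPoly ts)
  jPoly-negate []       = ≡.refl
  jPoly-negate (t ∷ ts) = cong (λ p → _ ∷ _ ∷ p) (jPoly-negate ts)

  InJ-resp : ∀ f g → f ≋ g → InJ f → InJ g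
  InJ-resp _ _ f≋g (ts , h) = ts , λ w → trans (sym (f≋g w)) (h w)

  InJ-++ : ∀ {f g} → InJ f → InJ g → InJ (f ++ g)
  InJ-++ {f} {g} (ts , hf) (us , hg) = ts ++ us , λ w → begin
    coeff (f ++ g) w                          ≈⟨ coeff-++ f g w ⟩
    coeff f w +ᴿ coeff g w                    ≈⟨ +-cong (hf w) (hg w) ⟩
    coeff (jPoly ts) w +ᴿ coeff (jPoly us) w  ≈⟨ coeff-++ (jPoly ts) (jPoly us) w ⟨
    coeff (jPoly ts ++ jPoly us) w            ≡⟨ cong (λ p → coeff p w) (jPoly-++ ts us) ⟨
    coeff (jPoly (ts ++ us)) w                ∎

  InJ-negate : ∀ {f} → InJ f → InJ (negate f)
  InJ-negate {f} (ts , h) = map negateJTerm ts , λ w → begin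
    coeff (negate f) w                   ≈⟨ coeff-negate f w ⟩
    - coeff f w                          ≈⟨ -‿cong (h w) ⟩
    - coeff (jPoly ts) w                 ≈⟨ coeff-negate (jPoly ts) w ⟨
    coeff (negate (jPoly ts)) w          ≡⟨ cong (λ p → coeff p w) (jPoly-negate ts) ⟨
    coeff (jPoly (map negateJTerm ts)) w ∎

  monomial : Word → Word → K
  monomial x w = coeff ((1# , x) ∷ []) w

  difference : Word → Word → Poly
  difference x y = (1# , x) ∷ (- 1# , y) ∷ []

  coeff-difference : ∀ x y w →
    coeff (difference x y) w ≈ monomial x w - monomial y w
  coeff-difference x y w =
    trans (coeff-++ ((1# , x) ∷ []) ((- 1# , y) ∷ []) w)
          (+-congˡ (coeff-negate ((1# , y) ∷ []) w))

  ≡J-refl : ∀ x → x ≡J x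
  ≡J-refl x = InJ-resp [] (difference x x) zero≋difference ([] , λ _ → refl)
    where
      zero≋difference : [] ≋ difference x x
      zero≋difference w =
        sym (trans (coeff-difference x x w) (-‿inverseʳ (monomial x w)))

  ≡J-sym : ∀ x y → x ≡J y → y ≡J x
  ≡J-sym x y x≡y =
    InJ-resp (negate (difference x y)) (difference y x) negated
             (InJ-negate {difference x y} x≡y)
    where
      negated : negate (difference x y) ≋ difference y x
      negated w = begin
        coeff (negate (difference x y)) w  ≈⟨ coeff-negate (difference x y) w ⟩
        - coeff (difference x y) w         ≈⟨ -‿cong (coeff-difference x y w) ⟩
        - (monomial x w - monomial y w)    ≈⟨ ⁻¹-anti-homo‿- _ _ ⟩
        monomial y w - monomial x w        ≈⟨ coeff-difference y x w ⟨
        coeff (difference y x) w           ∎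

  ≡J-trans : ∀ x y z → x ≡J y → y ≡J z → x ≡J z
  ≡J-trans x y z x≡y y≡z =
    InJ-resp (difference x y ++ difference y z) (difference x z) telescope
             (InJ-++ {difference x y} {difference y z} x≡y y≡z)
    where
      X = monomial x ; Y = monomial y ; Z = monomial z
      telescope : difference x y ++ difference y z ≋ difference x z
      telescope w = begin
        coeff (difference x y ++ difference y z) w
          ≈⟨ coeff-++ (difference x y) (difference y z) w ⟩
        coeff (difference x y) w +ᴿ coeff (difference y z) w
          ≈⟨ +-cong (coeff-difference x y w) (coeff-difference y z w) ⟩
        (X w - Y w) +ᴿ (Y w - Z w)    ≈⟨ +-assoc (X w) (- Y w) _ ⟩
        X w +ᴿ (- Y w +ᴿ (Y w - Z w)) ≈⟨ +-congˡ (\\-leftDividesʳ (Y w) (- Z w)) ⟩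
        X w - Z w                     ≈⟨ coeff-difference x z w ⟨
        coeff (difference x z) w      ∎

  relation-in-context : ∀ {l r} → IsRel l r → ∀ p q → (p ++ l ++ q) ≡J (p ++ r ++ q)
  relation-in-context {l} {r} rel p q = jterm 1# p l r rel q ∷ [] , λ _ → refl

  -- A single Knuth move between positive words is a congruence modulo J:
  -- far-apart outer letters commute, otherwise the move is rel2 or rel1.
  move-≡J : ∀ {x y} → KnuthMove x y → Positive x → x ≡J y
  move-≡J (bac→bca p q {a} {b} {c} a<b b≤c) h with positive-suffix p h
  ... | hb ∷ ha ∷ hc ∷ _ with a + 2 ≤? c
  ...   | yes far-apart =
          subst₂ _≡J_ (++-assoc p (b ∷ []) (a ∷ c ∷ q))
                      (++-assoc p (b ∷ []) (c ∷ a ∷ q))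
                 (relation-in-context (far ha hc (inj₁ far-apart)) (p ++ b ∷ []) q)
  ...   | no near with bac-near a<b b≤c (≰⇒> near)
  ...     | ≡.refl , ≡.refl =
          ≡J-sym (p ++ (a + 1) ∷ (a + 1) ∷ a ∷ q) (p ++ (a + 1) ∷ a ∷ (a + 1) ∷ q)
                 (relation-in-context (rel2 ha) p q)
  move-≡J (acb→cab p q {a} {b} {c} a≤b b<c) h with positive-suffix p h
  ... | ha ∷ hc ∷ _ with a + 2 ≤? c
  ...   | yes far-apart = relation-in-context (far ha hc (inj₁ far-apart)) p (b ∷ q)
  ...   | no near with acb-near a≤b b<c (≰⇒> near)
  ...     | ≡.refl , ≡.refl = relation-in-context (rel1 ha) p q

  knuthEquiv⇒≡J : ∀ {x y} → Positive x → KnuthEquiv x y → x ≡J y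
  knuthEquiv⇒≡J {x} _ ε = ≡J-refl x
  knuthEquiv⇒≡J {x} {z} h (_◅_ {j = y} (fwd move) moves) =
    ≡J-trans x y z (move-≡J move h)
                   (knuthEquiv⇒≡J (move-preserves-positive move h) moves)
  knuthEquiv⇒≡J {x} {z} h (_◅_ {j = y} (bwd move) moves) =
    ≡J-trans x y z (≡J-sym y x (move-≡J move h′)) (knuthEquiv⇒≡J h′ moves)
    where h′ = move-reflects-positive move h

mainTheorem8 : ∀ {c ℓ : Level} (R : CommutativeRing c ℓ) (x y : Word) →
    Positive x → Positive y → KnuthEquiv x y → Over._≡J_ R x y
mainTheorem8 R x y positive-x _ x∼y = Congruence.knuthEquiv⇒≡J R positive-x x∼y
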